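{- For every odd integer $n\ge 3$, $$\sum_{\substack{0\le k\le n\\ 6\mid k-3}}\binom nk4^kB_{n-k}=\begin{cases}\frac n3\big(1+2^{n-1}+3^{n-1}-2^{2n-3}-(-12)^{\frac{n-1}2}-V_{n-1}(2,13)\big)&\text{if } 6\mid n-1,\\ \frac n3\big(1+2^{n-1}+3^{n-1}+4^{n-1}-(-12)^{\frac{n-1}2}-V_{n-1}(2,13)\big)&\text{if } 6\nmid n-1.\end{cases}$$
   Context: The Bernoulli numbers $B_n$ are defined by $B_0=1$ and $\sum_{k=0}^{n-1}\binom nkB_k=0$ for $n\ge 2$. For numbers $b,c$, the Lucas sequence $V_n(b,c)$ is defined by $V_0(b,c)=2$, $V_1(b,c)=b$, $V_{n+1}(b,c)=bV_n(b,c)-cV_{n-1}(b,c)$ for $n\ge1$. -}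

module Defs where

open import Data.Nat as ℕ using (ℕ; zero; suc; _≤ᵇ_)
open import Data.Nat.Combinatorics using (_C_)
open import Data.Integer as ℤ using (ℤ; +_)
open import Data.Integer.Divisibility.Signed using (_∣_; _∣?_)
open import Data.Rational as ℚ using (ℚ; 0ℚ; 1ℚ; _+_; _*_; -_; _/_)
open import Data.Bool using (if_then_else_)
open import Relation.Nullary.Decidable using (does)

ℤtoℚ : ℤ → ℚ
ℤtoℚ z = z / 1

ℕtoℚ : ℕ → ℚ
ℕtoℚ n = + n / 1

sumTo : ℕ → (ℕ → ℚ) → ℚ
sumTo zero    f = f 0
sumTo (suc n) f = sumTo n f + f (suc n)

sumBelow : ℕ → (ℕ → ℚ) → ℚ
sumBelow zero    f = 0ℚ
sumBelow (suc n) f = sumBelow n f + f n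

-- bernUpTo m k = B_k for k ≤ m.
-- The defining relation  Σ_{k=0}^{n-1} C(n,k) B_k = 0  (n ≥ 2), taken with n = m+1,
-- determines  B_m = -(1/(m+1)) Σ_{k=0}^{m-1} C(m+1,k) B_k  for m ≥ 1.
bernUpTo : ℕ → ℕ → ℚ
bernUpTo zero    k = 1ℚ
bernUpTo (suc m) k =
  if k ℕ.≤ᵇ m then bernUpTo m k
  else - ((+ 1 / (suc (suc m))) *
          sumBelow (suc m) (λ j → ℕtoℚ (suc (suc m) C j) * bernUpTo m j))

B : ℕ → ℚ
B n = bernUpTo n n

V : ℕ → ℤ → ℤ → ℤ
V zero          b c = + 2
V (suc zero)    b c = b
V (suc (suc n)) b c = b ℤ.* V (suc n) b c ℤ.- c ℤ.* V n b c

lhs : ℕ → ℚ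
lhs n = sumTo n (λ k →
  if does (+ 6 ∣? (+ k ℤ.- + 3))
  then ℕtoℚ (n C k) * ℕtoℚ (4 ℕ.^ k) * B (n ℕ.∸ k)
  else 0ℚ)

{-# OPTIONS --safe #-}
-- Write n = 2h + 1 and work in ℚ(√-3), which contains the primitive sixth root of unity
-- ζ = (1 + √-3)/2.  Since Σⱼ (−1)ʲ (4ζʲ)ᵏ (j < 6) is 6·4ᵏ when 6 ∣ k − 3 and 0 otherwise, six
-- times the sum is Σⱼ (−1)ʲ Bₙ(4ζʲ) with the Bernoulli polynomial Bₙ(x) = Σₖ C(n,k) Bₙ₋ₖ xᵏ.
-- The six points pair up with integer differences, 4 = −4 + 8, 4ζ = 4ζ² + 4, 4ζ⁵ = 4ζ⁴ + 4,
-- so Bₙ(x + 1) − Bₙ(x) = n xⁿ⁻¹ telescopes the alternating sum into sixteen terms n ((x + t)²)ʰ.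
-- These squares are the integers t² and −12, the numbers (1 ± 2√-3)², whose h-th powers add
-- up to V_{n−1}(2,13), and 16ω, 16ω̄ for the cube roots of unity ω, ω̄, where ωʰ + ω̄ʰ is 2
-- or −1 according as 3 ∣ h, that is, as 6 ∣ n − 1.
module Submission where

open import Defs
open import Data.Nat as ℕ using (ℕ; _≤_; _∸_; _%_; _/_)
open import Data.Nat.Divisibility as ℕD using ()
open import Data.Integer as ℤ using (ℤ; +_; -_; _-_; _^_)
open import Data.Rational as ℚ using (ℚ)
open import Relation.Binary.PropositionalEquality using (_≡_)
open import Relation.Nullary using (¬_)
open import Data.Product using (_×_)

open import Algebra.Bundles using (CommutativeRing)
import Algebra.Properties.CommutativeSemigroup as CommutativeSemigroupProperties
import Algebra.Properties.CommutativeSemiring.Binomial as Binomial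
import Algebra.Properties.Monoid.Mult as MonoidMult
import Algebra.Properties.Monoid.Sum as MonoidSum
import Algebra.Solver.Ring.AlmostCommutativeRing as ACR
import Algebra.Solver.Ring.Simple as RingSolver
open import Data.Bool using (Bool; true; false; if_then_else_)
import Data.Fin as Fin
open import Data.Integer.Divisibility.Signed as ℤD using (_∣?_)
import Data.Integer.Properties as ℤP
import Data.Integer.Tactic.RingSolver as ℤ-Solver
open import Data.List.Base using (_∷_; [])
open import Data.Nat using (zero; suc; z≤n; s≤s; _!)
open import Data.Nat.Combinatorics
  using (_C_; nCk≡n!/k![n-k]!; k![n∸k]!∣n!; k>n⇒nCk≡0; nCk≡nC[n∸k]; nCn≡1; nC1≡n)
import Data.Nat.DivMod as ℕDM
import Data.Nat.Properties as ℕP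
import Data.Nat.Tactic.RingSolver as ℕ-Solver
open import Data.Product using (_,_)
open import Data.Rational using (0ℚ; 1ℚ)
import Data.Rational.Properties as ℚP
open import Data.Rational.Solver using (module +-*-Solver)
open import Data.Rational.Unnormalised as ℚᵘ using (mkℚᵘ; *≡*)
import Data.Rational.Unnormalised.Properties as ℚᵘP
open import Data.Sum using (inj₁; inj₂)
open import Function using (_∘_)
open import Function.Bundles using (_⇔_; mk⇔; Equivalence)
open import Level using (0ℓ)
open import Relation.Binary.Definitions using (DecidableEquality)
open import Relation.Binary.PropositionalEquality
  using (refl; sym; trans; cong; cong₂; subst; isEquivalence; module ≡-Reasoning)
open import Relation.Nullary using (yes; no; contradiction)
open import Relation.Nullary.Decidable using (does; does-⇔)

-- ⟨ a , b ⟩ stands for a + b√d.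
record ℚ[√_] (d : ℚ) : Set where
  constructor ⟨_,_⟩
  field
    re im : ℚ

module QuadraticField (d : ℚ) where

  open +-*-Solver using (solve; _:=_; _:+_; _:*_)

  infixl 6 _+_
  infixl 7 _*_

  _+_ : ℚ[√ d ] → ℚ[√ d ] → ℚ[√ d ]
  ⟨ a , b ⟩ + ⟨ a′ , b′ ⟩ = ⟨ a ℚ.+ a′ , b ℚ.+ b′ ⟩

  _*_ : ℚ[√ d ] → ℚ[√ d ] → ℚ[√ d ]
  ⟨ a , b ⟩ * ⟨ a′ , b′ ⟩ = ⟨ a ℚ.* a′ ℚ.+ d ℚ.* (b ℚ.* b′) , a ℚ.* b′ ℚ.+ b ℚ.* a′ ⟩

  negate : ℚ[√ d ] → ℚ[√ d ]
  negate ⟨ a , b ⟩ = ⟨ ℚ.- a , ℚ.- b ⟩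

  fromℚ : ℚ → ℚ[√ d ]
  fromℚ q = ⟨ q , 0ℚ ⟩

  private
    ⟨⟩-cong : ∀ {a b a′ b′} → a ≡ a′ → b ≡ b′ → _≡_ {A = ℚ[√ d ]} ⟨ a , b ⟩ ⟨ a′ , b′ ⟩
    ⟨⟩-cong = cong₂ ⟨_,_⟩

  +-assoc : ∀ x y z → (x + y) + z ≡ x + (y + z)
  +-assoc ⟨ a , b ⟩ ⟨ a′ , b′ ⟩ ⟨ a″ , b″ ⟩ = ⟨⟩-cong (ℚP.+-assoc a a′ a″) (ℚP.+-assoc b b′ b″)

  +-comm : ∀ x y → x + y ≡ y + x
  +-comm ⟨ a , b ⟩ ⟨ a′ , b′ ⟩ = ⟨⟩-cong (ℚP.+-comm a a′) (ℚP.+-comm b b′)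

  +-identityˡ : ∀ x → fromℚ 0ℚ + x ≡ x
  +-identityˡ ⟨ a , b ⟩ = ⟨⟩-cong (ℚP.+-identityˡ a) (ℚP.+-identityˡ b)

  +-identityʳ : ∀ x → x + fromℚ 0ℚ ≡ x
  +-identityʳ x = trans (+-comm x (fromℚ 0ℚ)) (+-identityˡ x)

  +-inverseˡ : ∀ x → negate x + x ≡ fromℚ 0ℚ
  +-inverseˡ ⟨ a , b ⟩ = ⟨⟩-cong (ℚP.+-inverseˡ a) (ℚP.+-inverseˡ b)

  +-inverseʳ : ∀ x → x + negate x ≡ fromℚ 0ℚ
  +-inverseʳ x = trans (+-comm x (negate x)) (+-inverseˡ x)

  *-comm : ∀ x y → x * y ≡ y * x
  *-comm ⟨ a , b ⟩ ⟨ a′ , b′ ⟩ = ⟨⟩-cong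
    (solve 5 (λ d a b a′ b′ → a :* a′ :+ d :* (b :* b′) := a′ :* a :+ d :* (b′ :* b)) refl d a b a′ b′)
    (solve 4 (λ a b a′ b′ → a :* b′ :+ b :* a′ := a′ :* b :+ b′ :* a) refl a b a′ b′)

  *-assoc : ∀ x y z → (x * y) * z ≡ x * (y * z)
  *-assoc ⟨ a , b ⟩ ⟨ a′ , b′ ⟩ ⟨ a″ , b″ ⟩ = ⟨⟩-cong
    (solve 7 (λ d a b a′ b′ a″ b″ →
        (a :* a′ :+ d :* (b :* b′)) :* a″ :+ d :* ((a :* b′ :+ b :* a′) :* b″)
      := a :* (a′ :* a″ :+ d :* (b′ :* b″)) :+ d :* (b :* (a′ :* b″ :+ b′ :* a″)))
      refl d a b a′ b′ a″ b″)
    (solve 7 (λ d a b a′ b′ a″ b″ →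
        (a :* a′ :+ d :* (b :* b′)) :* b″ :+ (a :* b′ :+ b :* a′) :* a″
      := a :* (a′ :* b″ :+ b′ :* a″) :+ b :* (a′ :* a″ :+ d :* (b′ :* b″)))
      refl d a b a′ b′ a″ b″)

  *-identityˡ : ∀ x → fromℚ 1ℚ * x ≡ x
  *-identityˡ ⟨ a , b ⟩ = ⟨⟩-cong
    (solve 3 (λ d a b → con 1ℚ :* a :+ d :* (con 0ℚ :* b) := a) refl d a b)
    (solve 2 (λ a b → con 1ℚ :* b :+ con 0ℚ :* a := b) refl a b)
    where open +-*-Solver using (con)

  *-identityʳ : ∀ x → x * fromℚ 1ℚ ≡ x
  *-identityʳ x = trans (*-comm x (fromℚ 1ℚ)) (*-identityˡ x)

  *-distribˡ-+ : ∀ x y z → x * (y + z) ≡ x * y + x * z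
  *-distribˡ-+ ⟨ a , b ⟩ ⟨ a′ , b′ ⟩ ⟨ a″ , b″ ⟩ = ⟨⟩-cong
    (solve 7 (λ d a b a′ b′ a″ b″ →
        a :* (a′ :+ a″) :+ d :* (b :* (b′ :+ b″)) := (a :* a′ :+ d :* (b :* b′)) :+ (a :* a″ :+ d :* (b :* b″)))
      refl d a b a′ b′ a″ b″)
    (solve 6 (λ a b a′ b′ a″ b″ →
        a :* (b′ :+ b″) :+ b :* (a′ :+ a″) := (a :* b′ :+ b :* a′) :+ (a :* b″ :+ b :* a″))
      refl a b a′ b′ a″ b″)

  *-distribʳ-+ : ∀ x y z → (y + z) * x ≡ y * x + z * x
  *-distribʳ-+ x y z = begin
    (y + z) * x     ≡⟨ *-comm (y + z) x ⟩
    x * (y + z)     ≡⟨ *-distribˡ-+ x y z ⟩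
    x * y + x * z   ≡⟨ cong₂ _+_ (*-comm x y) (*-comm x z) ⟩
    y * x + z * x   ∎
    where open ≡-Reasoning

  +-*-commutativeRing : CommutativeRing 0ℓ 0ℓ
  +-*-commutativeRing = record
    { Carrier = ℚ[√ d ] ; _≈_ = _≡_ ; _+_ = _+_ ; _*_ = _*_ ; -_ = negate
    ; 0# = fromℚ 0ℚ ; 1# = fromℚ 1ℚ
    ; isCommutativeRing = record
      { isRing = record
        { +-isAbelianGroup = record
          { isGroup = record
            { isMonoid = record
              { isSemigroup = record
                { isMagma = record { isEquivalence = isEquivalence ; ∙-cong = cong₂ _+_ }
                ; assoc = +-assoc }
              ; identity = +-identityˡ , +-identityʳ }
            ; inverse = +-inverseˡ , +-inverseʳ
            ; ⁻¹-cong = cong negate }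
          ; comm = +-comm }
        ; *-cong = cong₂ _*_
        ; *-assoc = *-assoc
        ; *-identity = *-identityˡ , *-identityʳ
        ; distrib = *-distribˡ-+ , *-distribʳ-+ }
      ; *-comm = *-comm } }

  _≟_ : DecidableEquality ℚ[√ d ]
  ⟨ a , b ⟩ ≟ ⟨ a′ , b′ ⟩ with a ℚP.≟ a′ | b ℚP.≟ b′
  ... | yes refl | yes refl = yes refl
  ... | no a≢a′  | _        = no λ { refl → a≢a′ refl }
  ... | yes _    | no b≢b′  = no λ { refl → b≢b′ refl }

  fromℚ-homo-* : ∀ p q → fromℚ (p ℚ.* q) ≡ fromℚ p * fromℚ q
  fromℚ-homo-* p q = ⟨⟩-cong
    (solve 3 (λ d p q → p :* q := p :* q :+ d :* (con 0ℚ :* con 0ℚ)) refl d p q)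
    (solve 2 (λ p q → con 0ℚ := p :* con 0ℚ :+ con 0ℚ :* q) refl p q)
    where open +-*-Solver using (con)

  fromℚ-injective : ∀ {p q} → fromℚ p ≡ fromℚ q → p ≡ q
  fromℚ-injective = cong ℚ[√_].re

ℚ[√-3] : Set
ℚ[√-3] = ℚ[√ ℚ.- (+ 3 ℚ./ 1) ]

module K where
  open QuadraticField (ℚ.- (+ 3 ℚ./ 1)) public
    using (+-*-commutativeRing; _≟_; fromℚ; fromℚ-homo-*; fromℚ-injective)
  open CommutativeRing +-*-commutativeRing public
  open import Algebra.Properties.CommutativeSemiring.Exp commutativeSemiring public

module K-Solver = RingSolver (ACR.fromCommutativeRing K.+-*-commutativeRing) K._≟_

private
  toℚᵘ-ℤtoℚ : ∀ z → ℚ.toℚᵘ (ℤtoℚ z) ℚᵘ.≃ mkℚᵘ z 0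
  toℚᵘ-ℤtoℚ z = ℚP.toℚᵘ-fromℚᵘ (mkℚᵘ z 0)

  ℤ[a+b]*1≡[a*1+b*1]*1 : ∀ a b → (a ℤ.+ b) ℤ.* + 1 ≡ (a ℤ.* + 1 ℤ.+ b ℤ.* + 1) ℤ.* + 1
  ℤ[a+b]*1≡[a*1+b*1]*1 = ℤ-Solver.solve-∀

ℤtoℚ-homo-+ : ∀ a b → ℤtoℚ (a ℤ.+ b) ≡ ℤtoℚ a ℚ.+ ℤtoℚ b
ℤtoℚ-homo-+ a b = ℚP.toℚᵘ-injective (begin
  ℚ.toℚᵘ (ℤtoℚ (a ℤ.+ b))                   ≈⟨ toℚᵘ-ℤtoℚ (a ℤ.+ b) ⟩
  mkℚᵘ (a ℤ.+ b) 0                           ≈⟨ *≡* (ℤ[a+b]*1≡[a*1+b*1]*1 a b) ⟩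
  mkℚᵘ a 0 ℚᵘ.+ mkℚᵘ b 0                     ≈⟨ ℚᵘP.+-cong (toℚᵘ-ℤtoℚ a) (toℚᵘ-ℤtoℚ b) ⟨
  ℚ.toℚᵘ (ℤtoℚ a) ℚᵘ.+ ℚ.toℚᵘ (ℤtoℚ b)       ≈⟨ ℚP.toℚᵘ-homo-+ (ℤtoℚ a) (ℤtoℚ b) ⟨
  ℚ.toℚᵘ (ℤtoℚ a ℚ.+ ℤtoℚ b)                 ∎)
  where open ℚᵘP.≃-Reasoning

ℤtoℚ-homo-* : ∀ a b → ℤtoℚ (a ℤ.* b) ≡ ℤtoℚ a ℚ.* ℤtoℚ b
ℤtoℚ-homo-* a b = ℚP.toℚᵘ-injective (begin
  ℚ.toℚᵘ (ℤtoℚ (a ℤ.* b))                   ≈⟨ toℚᵘ-ℤtoℚ (a ℤ.* b) ⟩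
  mkℚᵘ (a ℤ.* b) 0                           ≈⟨ *≡* refl ⟩
  mkℚᵘ a 0 ℚᵘ.* mkℚᵘ b 0                     ≈⟨ ℚᵘP.*-cong (toℚᵘ-ℤtoℚ a) (toℚᵘ-ℤtoℚ b) ⟨
  ℚ.toℚᵘ (ℤtoℚ a) ℚᵘ.* ℚ.toℚᵘ (ℤtoℚ b)       ≈⟨ ℚP.toℚᵘ-homo-* (ℤtoℚ a) (ℤtoℚ b) ⟨
  ℚ.toℚᵘ (ℤtoℚ a ℚ.* ℤtoℚ b)                 ∎)
  where open ℚᵘP.≃-Reasoning

ℤtoℚ-homo‿- : ∀ a → ℤtoℚ (ℤ.- a) ≡ ℚ.- ℤtoℚ a
ℤtoℚ-homo‿- a = ℚP.toℚᵘ-injective (begin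
  ℚ.toℚᵘ (ℤtoℚ (ℤ.- a))          ≈⟨ toℚᵘ-ℤtoℚ (ℤ.- a) ⟩
  ℚᵘ.- mkℚᵘ a 0                   ≈⟨ ℚᵘP.-‿cong (toℚᵘ-ℤtoℚ a) ⟨
  ℚᵘ.- ℚ.toℚᵘ (ℤtoℚ a)            ≈⟨ ℚP.toℚᵘ-homo‿- (ℤtoℚ a) ⟨
  ℚ.toℚᵘ (ℚ.- ℤtoℚ a)            ∎)
  where open ℚᵘP.≃-Reasoning

n*[1/n]≡1 : ∀ n .{{_ : ℕ.NonZero n}} → ℕtoℚ n ℚ.* (+ 1 ℚ./ n) ≡ 1ℚ
n*[1/n]≡1 (suc n) = ℚP.toℚᵘ-injective (begin
  ℚ.toℚᵘ (ℕtoℚ (suc n) ℚ.* (+ 1 ℚ./ suc n))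
    ≈⟨ ℚP.toℚᵘ-homo-* (ℕtoℚ (suc n)) (+ 1 ℚ./ suc n) ⟩
  ℚ.toℚᵘ (ℕtoℚ (suc n)) ℚᵘ.* ℚ.toℚᵘ (+ 1 ℚ./ suc n)
    ≈⟨ ℚᵘP.*-cong (toℚᵘ-ℤtoℚ (+ suc n)) (ℚP.toℚᵘ-fromℚᵘ (mkℚᵘ (+ 1) n)) ⟩
  mkℚᵘ (+ suc n) 0 ℚᵘ.* mkℚᵘ (+ 1) n
    ≈⟨ *≡* (cong (λ t → + suc t) (ℕ-Solver.solve (n ∷ []))) ⟩
  ℚ.toℚᵘ 1ℚ ∎)
  where open ℚᵘP.≃-Reasoning

+n/d≡n*[1/d] : ∀ n d .{{_ : ℕ.NonZero d}} → + n ℚ./ d ≡ ℕtoℚ n ℚ.* (+ 1 ℚ./ d)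
+n/d≡n*[1/d] n (suc d) = ℚP.toℚᵘ-injective (begin
  ℚ.toℚᵘ (+ n ℚ./ suc d)
    ≈⟨ ℚP.toℚᵘ-fromℚᵘ (mkℚᵘ (+ n) d) ⟩
  mkℚᵘ (+ n) d
    ≈⟨ *≡* (cong₂ ℤ._*_ (sym (ℤP.*-identityʳ (+ n))) (cong (λ t → + suc t) (ℕP.+-identityʳ d))) ⟩
  mkℚᵘ (+ n) 0 ℚᵘ.* mkℚᵘ (+ 1) d
    ≈⟨ ℚᵘP.*-cong (toℚᵘ-ℤtoℚ (+ n)) (ℚP.toℚᵘ-fromℚᵘ (mkℚᵘ (+ 1) d)) ⟨
  ℚ.toℚᵘ (ℕtoℚ n) ℚᵘ.* ℚ.toℚᵘ (+ 1 ℚ./ suc d)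
    ≈⟨ ℚP.toℚᵘ-homo-* (ℕtoℚ n) (+ 1 ℚ./ suc d) ⟨
  ℚ.toℚᵘ (ℕtoℚ n ℚ.* (+ 1 ℚ./ suc d)) ∎)
  where open ℚᵘP.≃-Reasoning

fromℤ : ℤ → ℚ[√-3]
fromℤ z = K.fromℚ (ℤtoℚ z)

fromℕ : ℕ → ℚ[√-3]
fromℕ n = fromℤ (+ n)

fromℤ-homo-+ : ∀ a b → fromℤ (a ℤ.+ b) ≡ fromℤ a K.+ fromℤ b
fromℤ-homo-+ a b = cong K.fromℚ (ℤtoℚ-homo-+ a b)

fromℤ-homo-* : ∀ a b → fromℤ (a ℤ.* b) ≡ fromℤ a K.* fromℤ b
fromℤ-homo-* a b = trans (cong K.fromℚ (ℤtoℚ-homo-* a b)) (K.fromℚ-homo-* (ℤtoℚ a) (ℤtoℚ b))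

fromℤ-homo-- : ∀ a b → fromℤ (a - b) ≡ fromℤ a K.- fromℤ b
fromℤ-homo-- a b = trans (fromℤ-homo-+ a (- b)) (cong (fromℤ a K.+_) (cong K.fromℚ (ℤtoℚ-homo‿- b)))

fromℤ-homo-^ : ∀ z n → fromℤ (z ^ n) ≡ fromℤ z K.^ n
fromℤ-homo-^ z zero    = refl
fromℤ-homo-^ z (suc n) = trans (fromℤ-homo-* z (z ^ n)) (cong (fromℤ z K.*_) (fromℤ-homo-^ z n))

fromℕ-homo-+ : ∀ m n → fromℕ (m ℕ.+ n) ≡ fromℕ m K.+ fromℕ n
fromℕ-homo-+ m n = trans (cong fromℤ (ℤP.pos-+ m n)) (fromℤ-homo-+ (+ m) (+ n))

fromℕ-homo-* : ∀ m n → fromℕ (m ℕ.* n) ≡ fromℕ m K.* fromℕ n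
fromℕ-homo-* m n = trans (cong fromℤ (ℤP.pos-* m n)) (fromℤ-homo-* (+ m) (+ n))

fromℕ-homo-^ : ∀ m k → fromℕ (m ℕ.^ k) ≡ fromℕ m K.^ k
fromℕ-homo-^ m zero    = refl
fromℕ-homo-^ m (suc k) = trans (fromℕ-homo-* m (m ℕ.^ k)) (cong (fromℕ m K.*_) (fromℕ-homo-^ m k))

x*6≡n*E*2⇒x≡n/3*E : ∀ n x E →
  K.fromℚ x K.* fromℕ 6 ≡ fromℕ n K.* fromℤ E K.* fromℕ 2 → x ≡ (+ n ℚ./ 3) ℚ.* ℤtoℚ E
x*6≡n*E*2⇒x≡n/3*E n x E eq = begin
  x                                            ≡⟨ solve 1 (λ x → x := x :* con 6ℚ :* con ⅙) refl x ⟩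
  x ℚ.* 6ℚ ℚ.* ⅙                               ≡⟨ cong (ℚ._* ⅙) x*6≡n*E*2 ⟩
  ℕtoℚ n ℚ.* ℤtoℚ E ℚ.* 2ℚ ℚ.* ⅙               ≡⟨ solve 2 (λ n e → n :* e :* con 2ℚ :* con ⅙ := n :* con ⅓ :* e)
                                                          refl (ℕtoℚ n) (ℤtoℚ E) ⟩
  ℕtoℚ n ℚ.* ⅓ ℚ.* ℤtoℚ E                      ≡⟨ cong (ℚ._* ℤtoℚ E) (+n/d≡n*[1/d] n 3) ⟨
  (+ n ℚ./ 3) ℚ.* ℤtoℚ E                       ∎
  where
  open ≡-Reasoning
  open +-*-Solver using (solve; _:=_; _:*_; con)
  6ℚ 2ℚ ⅙ ⅓ : ℚ
  6ℚ = ℕtoℚ 6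
  2ℚ = ℕtoℚ 2
  ⅙ = + 1 ℚ./ 6
  ⅓ = + 1 ℚ./ 3
  x*6≡n*E*2 : x ℚ.* 6ℚ ≡ ℕtoℚ n ℚ.* ℤtoℚ E ℚ.* 2ℚ
  x*6≡n*E*2 = K.fromℚ-injective (begin
    K.fromℚ (x ℚ.* 6ℚ)                        ≡⟨ K.fromℚ-homo-* x 6ℚ ⟩
    K.fromℚ x K.* fromℕ 6                     ≡⟨ eq ⟩
    fromℕ n K.* fromℤ E K.* fromℕ 2           ≡⟨ cong (K._* fromℕ 2) (K.fromℚ-homo-* (ℕtoℚ n) (ℤtoℚ E)) ⟨
    K.fromℚ (ℕtoℚ n ℚ.* ℤtoℚ E) K.* fromℕ 2   ≡⟨ K.fromℚ-homo-* (ℕtoℚ n ℚ.* ℤtoℚ E) 2ℚ ⟨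
    K.fromℚ (ℕtoℚ n ℚ.* ℤtoℚ E ℚ.* 2ℚ)        ∎)

∑ : ℕ → (ℕ → ℚ[√-3]) → ℚ[√-3]
∑ zero    f = K.0#
∑ (suc n) f = ∑ n f K.+ f n

∑-cong : ∀ n {f g} → (∀ k → k ℕ.< n → f k ≡ g k) → ∑ n f ≡ ∑ n g
∑-cong zero    f≗g = refl
∑-cong (suc n) f≗g = cong₂ K._+_ (∑-cong n (λ k k<n → f≗g k (ℕP.m<n⇒m<1+n k<n))) (f≗g n (ℕP.n<1+n n))

∑-zero : ∀ n {f} → (∀ k → k ℕ.< n → f k ≡ K.0#) → ∑ n f ≡ K.0#
∑-zero zero    f≗0 = refl
∑-zero (suc n) f≗0 = trans
  (cong₂ K._+_ (∑-zero n (λ k k<n → f≗0 k (ℕP.m<n⇒m<1+n k<n))) (f≗0 n (ℕP.n<1+n n)))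
  (K.+-identityˡ K.0#)

∑-distrib-+ : ∀ n f g → ∑ n (λ k → f k K.+ g k) ≡ ∑ n f K.+ ∑ n g
∑-distrib-+ zero    f g = sym (K.+-identityˡ K.0#)
∑-distrib-+ (suc n) f g = trans (cong (K._+ (f n K.+ g n)) (∑-distrib-+ n f g))
  (CommutativeSemigroupProperties.interchange K.+-commutativeSemigroup (∑ n f) (∑ n g) (f n) (g n))

*-distribˡ-∑ : ∀ n c f → c K.* ∑ n f ≡ ∑ n (λ k → c K.* f k)
*-distribˡ-∑ zero    c f = K.zeroʳ c
*-distribˡ-∑ (suc n) c f = trans (K.distribˡ c (∑ n f) (f n)) (cong (K._+ c K.* f n) (*-distribˡ-∑ n c f))

*-distribʳ-∑ : ∀ n c f → ∑ n f K.* c ≡ ∑ n (λ k → f k K.* c)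
*-distribʳ-∑ n c f = trans (K.*-comm (∑ n f) c)
  (trans (*-distribˡ-∑ n c f) (∑-cong n (λ k _ → K.*-comm c (f k))))

∑-head : ∀ n f → ∑ (suc n) f ≡ f 0 K.+ ∑ n (f ∘ suc)
∑-head zero    f = trans (K.+-identityˡ (f 0)) (sym (K.+-identityʳ (f 0)))
∑-head (suc n) f = trans (cong (K._+ f (suc n)) (∑-head n f)) (K.+-assoc (f 0) (∑ n (f ∘ suc)) (f (suc n)))

∑-comm : ∀ m n (f : ℕ → ℕ → ℚ[√-3]) → ∑ m (λ i → ∑ n (f i)) ≡ ∑ n (λ j → ∑ m (λ i → f i j))
∑-comm zero    n f = sym (∑-zero n (λ _ _ → refl))
∑-comm (suc m) n f = trans (cong (K._+ ∑ n (f m)) (∑-comm m n f))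
  (sym (∑-distrib-+ n (λ j → ∑ m (λ i → f i j)) (f m)))

∑-drop-leading-zeros : ∀ i m f → (∀ k → k ℕ.< i → f k ≡ K.0#) → ∑ (i ℕ.+ m) f ≡ ∑ m (λ l → f (i ℕ.+ l))
∑-drop-leading-zeros zero    m f f≗0 = refl
∑-drop-leading-zeros (suc i) m f f≗0 = begin
  ∑ (suc (i ℕ.+ m)) f                               ≡⟨ ∑-head (i ℕ.+ m) f ⟩
  f 0 K.+ ∑ (i ℕ.+ m) (f ∘ suc)                     ≡⟨ cong₂ K._+_ (f≗0 0 (s≤s z≤n)) tail-sum ⟩
  K.0# K.+ ∑ m (λ l → f (suc i ℕ.+ l))              ≡⟨ K.+-identityˡ _ ⟩
  ∑ m (λ l → f (suc i ℕ.+ l))                       ∎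
  where
  open ≡-Reasoning
  tail-sum : ∑ (i ℕ.+ m) (f ∘ suc) ≡ ∑ m (λ l → f (suc i ℕ.+ l))
  tail-sum = ∑-drop-leading-zeros i m (f ∘ suc) (λ k k<i → f≗0 (suc k) (s≤s k<i))

∑-drop-trailing-zeros : ∀ n m f → (∀ k → n ≤ k → f k ≡ K.0#) → ∑ (n ℕ.+ m) f ≡ ∑ n f
∑-drop-trailing-zeros n zero    f f≗0 = cong (λ t → ∑ t f) (ℕP.+-identityʳ n)
∑-drop-trailing-zeros n (suc m) f f≗0 = begin
  ∑ (n ℕ.+ suc m) f                  ≡⟨ cong (λ t → ∑ t f) (ℕP.+-suc n m) ⟩
  ∑ (n ℕ.+ m) f K.+ f (n ℕ.+ m)      ≡⟨ cong₂ K._+_ (∑-drop-trailing-zeros n m f f≗0)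
                                                    (f≗0 (n ℕ.+ m) (ℕP.m≤m+n n m)) ⟩
  ∑ n f K.+ K.0#                     ≡⟨ K.+-identityʳ (∑ n f) ⟩
  ∑ n f                              ∎
  where open ≡-Reasoning

∑-reverse : ∀ n f → ∑ n f ≡ ∑ n (λ k → f (n ∸ suc k))
∑-reverse zero    f = refl
∑-reverse (suc n) f = begin
  ∑ n f K.+ f n                              ≡⟨ cong (K._+ f n) (∑-reverse n f) ⟩
  ∑ n (λ k → f (n ∸ suc k)) K.+ f n          ≡⟨ K.+-comm _ (f n) ⟩
  f n K.+ ∑ n (λ k → f (n ∸ suc k))          ≡⟨ ∑-head n (λ k → f (suc n ∸ suc k)) ⟨
  ∑ (suc n) (λ k → f (suc n ∸ suc k))        ∎
  where open ≡-Reasoning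

fromℚ-sumBelow : ∀ n f → K.fromℚ (sumBelow n f) ≡ ∑ n (K.fromℚ ∘ f)
fromℚ-sumBelow zero    f = refl
fromℚ-sumBelow (suc n) f = cong (K._+ K.fromℚ (f n)) (fromℚ-sumBelow n f)

fromℚ-sumTo : ∀ n f → K.fromℚ (sumTo n f) ≡ ∑ (suc n) (K.fromℚ ∘ f)
fromℚ-sumTo zero    f = sym (K.+-identityˡ (K.fromℚ (f 0)))
fromℚ-sumTo (suc n) f = cong (K._+ K.fromℚ (f (suc n))) (fromℚ-sumTo n f)

∑-from-sum : ∀ n f → MonoidSum.sum K.+-monoid {n} (f ∘ Fin.toℕ) ≡ ∑ n f
∑-from-sum zero    f = refl
∑-from-sum (suc n) f = trans (cong (f 0 K.+_) (∑-from-sum n (f ∘ suc))) (sym (∑-head n f))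

×≡fromℕ* : ∀ m x → MonoidMult._×_ K.+-monoid m x ≡ fromℕ m K.* x
×≡fromℕ* zero    x = sym (K.zeroˡ x)
×≡fromℕ* (suc m) x = begin
  x K.+ MonoidMult._×_ K.+-monoid m x      ≡⟨ cong₂ K._+_ (sym (K.*-identityˡ x)) (×≡fromℕ* m x) ⟩
  K.1# K.* x K.+ fromℕ m K.* x             ≡⟨ K.distribʳ x K.1# (fromℕ m) ⟨
  (K.1# K.+ fromℕ m) K.* x                 ≡⟨ cong (K._* x) (fromℕ-homo-+ 1 m) ⟨
  fromℕ (suc m) K.* x                      ∎
  where open ≡-Reasoning

1^n≡1 : ∀ n → K.1# K.^ n ≡ K.1#
1^n≡1 zero    = refl
1^n≡1 (suc n) = trans (K.*-identityˡ (K.1# K.^ n)) (1^n≡1 n)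

binomial-theorem : ∀ n x → (x K.+ K.1#) K.^ n ≡ ∑ (suc n) (λ k → fromℕ (n C k) K.* x K.^ k)
binomial-theorem n x = begin
  (x K.+ K.1#) K.^ n                                    ≡⟨ Binomial.theorem K.commutativeSemiring n x K.1# ⟩
  MonoidSum.sum K.+-monoid {suc n} (term ∘ Fin.toℕ)     ≡⟨ ∑-from-sum (suc n) term ⟩
  ∑ (suc n) term                                        ≡⟨ ∑-cong (suc n) (λ k _ → term≡ k) ⟩
  ∑ (suc n) (λ k → fromℕ (n C k) K.* x K.^ k)           ∎
  where
  open ≡-Reasoning
  term : ℕ → ℚ[√-3]
  term k = MonoidMult._×_ K.+-monoid (n C k) (x K.^ k K.* K.1# K.^ (n ∸ k))
  term≡ : ∀ k → term k ≡ fromℕ (n C k) K.* x K.^ k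
  term≡ k = trans (×≡fromℕ* (n C k) _)
    (cong (fromℕ (n C k) K.*_) (trans (cong (x K.^ k K.*_) (1^n≡1 (n ∸ k))) (K.*-identityʳ (x K.^ k))))

[1+n]Cn≡1+n : ∀ n → suc n C n ≡ suc n
[1+n]Cn≡1+n n = trans (nCk≡nC[n∸k] (ℕP.n≤1+n n)) (trans (cong (suc n C_) (ℕP.m+n∸n≡m 1 n)) (nC1≡n (suc n)))

nCk*[k!*[n∸k]!]≡n! : ∀ {n k} → k ≤ n → (n C k) ℕ.* (k ! ℕ.* (n ∸ k) !) ≡ n !
nCk*[k!*[n∸k]!]≡n! {n} {k} k≤n = begin
  (n C k) ℕ.* (k ! ℕ.* (n ∸ k) !)    ≡⟨ cong (ℕ._* (k ! ℕ.* (n ∸ k) !)) (nCk≡n!/k![n-k]! k≤n) ⟩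
  _                                ≡⟨ ℕDM.m/n*n≡m {{k ℕP.!* (n ∸ k) !≢0}} (k![n∸k]!∣n! k≤n) ⟩
  n !                              ∎
  where open ≡-Reasoning

nC[i+l]*[i+l]Ci≡nCi*[n∸i]Cl : ∀ {n} i l → i ℕ.+ l ≤ n →
  (n C (i ℕ.+ l)) ℕ.* ((i ℕ.+ l) C i) ≡ (n C i) ℕ.* ((n ∸ i) C l)
nC[i+l]*[i+l]Ci≡nCi*[n∸i]Cl {n} i l i+l≤n =
  ℕP.*-cancelʳ-≡ _ _ (i ! ℕ.* l ! ℕ.* r !) {{nonZero}} (trans lhs≡n! (sym rhs≡n!))
  where
  open ≡-Reasoning
  r = n ∸ (i ℕ.+ l)
  nonZero : ℕ.NonZero (i ! ℕ.* l ! ℕ.* r !)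
  nonZero = ℕP.m*n≢0 _ _ {{ℕP.m*n≢0 _ _ {{i ℕP.!≢0}} {{l ℕP.!≢0}}}} {{r ℕP.!≢0}}
  regroupˡ : ∀ a b c d e → a ℕ.* b ℕ.* (c ℕ.* d ℕ.* e) ≡ a ℕ.* (b ℕ.* (c ℕ.* d) ℕ.* e)
  regroupˡ = ℕ-Solver.solve-∀
  regroupʳ : ∀ a b c d e → a ℕ.* b ℕ.* (c ℕ.* d ℕ.* e) ≡ a ℕ.* (c ℕ.* (b ℕ.* (d ℕ.* e)))
  regroupʳ = ℕ-Solver.solve-∀
  i≤n : i ≤ n
  i≤n = ℕP.≤-trans (ℕP.m≤m+n i l) i+l≤n
  lhs≡n! : (n C (i ℕ.+ l)) ℕ.* ((i ℕ.+ l) C i) ℕ.* (i ! ℕ.* l ! ℕ.* r !) ≡ n !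
  lhs≡n! = begin
    (n C (i ℕ.+ l)) ℕ.* ((i ℕ.+ l) C i) ℕ.* (i ! ℕ.* l ! ℕ.* r !)
      ≡⟨ regroupˡ (n C (i ℕ.+ l)) ((i ℕ.+ l) C i) (i !) (l !) (r !) ⟩
    (n C (i ℕ.+ l)) ℕ.* (((i ℕ.+ l) C i) ℕ.* (i ! ℕ.* l !) ℕ.* r !)
      ≡⟨ cong (λ t → (n C (i ℕ.+ l)) ℕ.* (((i ℕ.+ l) C i) ℕ.* (i ! ℕ.* t !) ℕ.* r !)) (sym (ℕP.m+n∸m≡n i l)) ⟩
    (n C (i ℕ.+ l)) ℕ.* (((i ℕ.+ l) C i) ℕ.* (i ! ℕ.* (i ℕ.+ l ∸ i) !) ℕ.* r !)
      ≡⟨ cong (λ t → (n C (i ℕ.+ l)) ℕ.* (t ℕ.* r !)) (nCk*[k!*[n∸k]!]≡n! (ℕP.m≤m+n i l)) ⟩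
    (n C (i ℕ.+ l)) ℕ.* ((i ℕ.+ l) ! ℕ.* r !)
      ≡⟨ nCk*[k!*[n∸k]!]≡n! i+l≤n ⟩
    n ! ∎
  l≤n∸i : l ≤ n ∸ i
  l≤n∸i = ℕP.≤-trans (ℕP.≤-reflexive (sym (ℕP.m+n∸m≡n i l))) (ℕP.∸-monoˡ-≤ i i+l≤n)
  rhs≡n! : (n C i) ℕ.* ((n ∸ i) C l) ℕ.* (i ! ℕ.* l ! ℕ.* r !) ≡ n !
  rhs≡n! = begin
    (n C i) ℕ.* ((n ∸ i) C l) ℕ.* (i ! ℕ.* l ! ℕ.* r !)
      ≡⟨ regroupʳ (n C i) ((n ∸ i) C l) (i !) (l !) (r !) ⟩
    (n C i) ℕ.* (i ! ℕ.* (((n ∸ i) C l) ℕ.* (l ! ℕ.* r !)))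
      ≡⟨ cong (λ t → (n C i) ℕ.* (i ! ℕ.* (((n ∸ i) C l) ℕ.* (l ! ℕ.* t !)))) (sym (ℕP.∸-+-assoc n i l)) ⟩
    (n C i) ℕ.* (i ! ℕ.* (((n ∸ i) C l) ℕ.* (l ! ℕ.* (n ∸ i ∸ l) !)))
      ≡⟨ cong (λ t → (n C i) ℕ.* (i ! ℕ.* t)) (nCk*[k!*[n∸k]!]≡n! l≤n∸i) ⟩
    (n C i) ℕ.* (i ! ℕ.* (n ∸ i) !)
      ≡⟨ nCk*[k!*[n∸k]!]≡n! i≤n ⟩
    n ! ∎

-- Bernoulli numbers

bernUpTo-stable : ∀ {m k} → k ≤ m → bernUpTo m k ≡ B k
bernUpTo-stable {zero}  z≤n = refl
bernUpTo-stable {suc m} {k} k≤1+m with ℕP.m≤n⇒m<n∨m≡n k≤1+m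
... | inj₂ refl = refl
... | inj₁ (s≤s k≤m) with k ℕ.≤ᵇ m | ℕP.≤⇒≤ᵇ k≤m
...   | true | _ = bernUpTo-stable k≤m

private
  n<ᵇn≡false : ∀ n → (n ℕ.<ᵇ n) ≡ false
  n<ᵇn≡false zero    = refl
  n<ᵇn≡false (suc n) = n<ᵇn≡false n

B-suc : ∀ q → B (suc q) ≡
  ℚ.- ((+ 1 ℚ./ suc (suc q)) ℚ.* sumBelow (suc q) (λ j → ℕtoℚ (suc (suc q) C j) ℚ.* bernUpTo q j))
B-suc q rewrite n<ᵇn≡false q = refl

bernoulli-relation : ∀ q → ∑ (suc (suc q)) (λ k → fromℕ (suc (suc q) C k) K.* K.fromℚ (B k)) ≡ K.0#
bernoulli-relation q = begin
  ∑ (suc q) term K.+ term (suc q)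
    ≡⟨ cong₂ K._+_ init≡S last≡-S ⟩
  K.fromℚ S K.+ K.fromℚ (ℕtoℚ n) K.* K.fromℚ (ℚ.- (r ℚ.* S))
    ≡⟨ cong (K.fromℚ S K.+_) (K.fromℚ-homo-* (ℕtoℚ n) (ℚ.- (r ℚ.* S))) ⟨
  K.fromℚ (S ℚ.+ ℕtoℚ n ℚ.* (ℚ.- (r ℚ.* S)))
    ≡⟨ cong K.fromℚ (S+n*[-[r*S]]≡0 (n*[1/n]≡1 n)) ⟩
  K.0# ∎
  where
  open ≡-Reasoning
  n = suc (suc q)
  r = + 1 ℚ./ n
  S = sumBelow (suc q) (λ j → ℕtoℚ (n C j) ℚ.* bernUpTo q j)
  term : ℕ → ℚ[√-3]
  term k = fromℕ (n C k) K.* K.fromℚ (B k)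
  init≡S : ∑ (suc q) term ≡ K.fromℚ S
  init≡S = sym (trans (fromℚ-sumBelow (suc q) _) (∑-cong (suc q) λ j j<1+q →
    trans (K.fromℚ-homo-* (ℕtoℚ (n C j)) (bernUpTo q j))
          (cong (λ b → fromℕ (n C j) K.* K.fromℚ b) (bernUpTo-stable (ℕP.≤-pred j<1+q)))))
  last≡-S : term (suc q) ≡ K.fromℚ (ℕtoℚ n) K.* K.fromℚ (ℚ.- (r ℚ.* S))
  last≡-S = cong₂ (λ c b → fromℕ c K.* K.fromℚ b) ([1+n]Cn≡1+n (suc q)) (B-suc q)
  S+n*[-[r*S]]≡0 : ℕtoℚ n ℚ.* r ≡ 1ℚ → S ℚ.+ ℕtoℚ n ℚ.* (ℚ.- (r ℚ.* S)) ≡ 0ℚ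
  S+n*[-[r*S]]≡0 n*r≡1 = begin
    S ℚ.+ ℕtoℚ n ℚ.* (ℚ.- (r ℚ.* S))   ≡⟨ solve 3 (λ S n r → S :+ n :* (:- (r :* S)) := S :- n :* r :* S)
                                                  refl S (ℕtoℚ n) r ⟩
    S ℚ.- ℕtoℚ n ℚ.* r ℚ.* S           ≡⟨ cong (λ t → S ℚ.- t ℚ.* S) n*r≡1 ⟩
    S ℚ.- 1ℚ ℚ.* S                     ≡⟨ solve 1 (λ S → S :- con 1ℚ :* S := con 0ℚ) refl S ⟩
    0ℚ                                 ∎
    where open +-*-Solver using (solve; _:=_; _:+_; _:*_; _:-_; :-_; con)

δ₁ : ℕ → ℚ[√-3]
δ₁ 1 = K.1#
δ₁ _ = K.0#

∑-C-B : ∀ m → ∑ (suc m) (λ k → fromℕ (m C k) K.* K.fromℚ (B k)) ≡ K.fromℚ (B m) K.+ δ₁ m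
∑-C-B zero          = refl
∑-C-B (suc zero)    = refl
∑-C-B (suc (suc q)) = begin
  ∑ (suc (suc q)) term K.+ fromℕ (suc (suc q) C suc (suc q)) K.* K.fromℚ (B (suc (suc q)))
    ≡⟨ cong₂ (λ s c → s K.+ fromℕ c K.* K.fromℚ (B (suc (suc q)))) (bernoulli-relation q) (nCn≡1 (suc (suc q))) ⟩
  K.0# K.+ K.1# K.* K.fromℚ (B (suc (suc q)))
    ≡⟨ solve 1 (λ b → con K.0# :+ con K.1# :* b := b :+ con K.0#) refl (K.fromℚ (B (suc (suc q)))) ⟩
  K.fromℚ (B (suc (suc q))) K.+ K.0# ∎
  where
  open ≡-Reasoning
  open K-Solver using (solve; _:=_; _:+_; _:*_; con)
  term : ℕ → ℚ[√-3]
  term k = fromℕ (suc (suc q) C k) K.* K.fromℚ (B k)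

∑-C-B[m∸k] : ∀ m → ∑ (suc m) (λ k → fromℕ (m C k) K.* K.fromℚ (B (m ∸ k))) ≡ K.fromℚ (B m) K.+ δ₁ m
∑-C-B[m∸k] m = trans (∑-reverse (suc m) _) (trans (∑-cong (suc m) reflect) (∑-C-B m))
  where
  reflect : ∀ k → k ℕ.< suc m →
    fromℕ (m C (m ∸ k)) K.* K.fromℚ (B (m ∸ (m ∸ k))) ≡ fromℕ (m C k) K.* K.fromℚ (B k)
  reflect k k<1+m = cong₂ (λ c b → fromℕ c K.* K.fromℚ (B b))
    (sym (nCk≡nC[n∸k] (ℕP.≤-pred k<1+m))) (ℕP.m∸[m∸n]≡n (ℕP.≤-pred k<1+m))

-- Bernoulli polynomials

bernoulliPoly : ℕ → ℚ[√-3] → ℚ[√-3]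
bernoulliPoly n x = ∑ (suc n) (λ j → fromℕ (n C j) K.* x K.^ j K.* K.fromℚ (B (n ∸ j)))

∑-C-C-B : ∀ {n i} → i ≤ n →
  ∑ (suc n) (λ j → fromℕ (n C j) K.* fromℕ (j C i) K.* K.fromℚ (B (n ∸ j)))
    ≡ fromℕ (n C i) K.* (K.fromℚ (B (n ∸ i)) K.+ δ₁ (n ∸ i))
∑-C-C-B {n} {i} i≤n = begin
  ∑ (suc n) term
    ≡⟨ cong (λ t → ∑ t term) i+[1+n∸i]≡1+n ⟨
  ∑ (i ℕ.+ suc (n ∸ i)) term
    ≡⟨ ∑-drop-leading-zeros i (suc (n ∸ i)) term below-i ⟩
  ∑ (suc (n ∸ i)) (λ l → term (i ℕ.+ l))
    ≡⟨ ∑-cong (suc (n ∸ i)) (λ l l<1+n∸i → revise l (ℕP.≤-pred l<1+n∸i)) ⟩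
  ∑ (suc (n ∸ i)) (λ l → fromℕ (n C i) K.* (fromℕ ((n ∸ i) C l) K.* K.fromℚ (B (n ∸ i ∸ l))))
    ≡⟨ *-distribˡ-∑ (suc (n ∸ i)) (fromℕ (n C i)) _ ⟨
  fromℕ (n C i) K.* ∑ (suc (n ∸ i)) (λ l → fromℕ ((n ∸ i) C l) K.* K.fromℚ (B (n ∸ i ∸ l)))
    ≡⟨ cong (fromℕ (n C i) K.*_) (∑-C-B[m∸k] (n ∸ i)) ⟩
  fromℕ (n C i) K.* (K.fromℚ (B (n ∸ i)) K.+ δ₁ (n ∸ i)) ∎
  where
  open ≡-Reasoning
  term : ℕ → ℚ[√-3]
  term j = fromℕ (n C j) K.* fromℕ (j C i) K.* K.fromℚ (B (n ∸ j))
  i+[1+n∸i]≡1+n : i ℕ.+ suc (n ∸ i) ≡ suc n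
  i+[1+n∸i]≡1+n = trans (ℕP.+-suc i (n ∸ i)) (cong suc (ℕP.m+[n∸m]≡n i≤n))
  below-i : ∀ j → j ℕ.< i → term j ≡ K.0#
  below-i j j<i = begin
    fromℕ (n C j) K.* fromℕ (j C i) K.* K.fromℚ (B (n ∸ j))
      ≡⟨ cong (λ c → fromℕ (n C j) K.* fromℕ c K.* K.fromℚ (B (n ∸ j))) (k>n⇒nCk≡0 j<i) ⟩
    fromℕ (n C j) K.* K.0# K.* K.fromℚ (B (n ∸ j))
      ≡⟨ cong (K._* K.fromℚ (B (n ∸ j))) (K.zeroʳ (fromℕ (n C j))) ⟩
    K.0# K.* K.fromℚ (B (n ∸ j))
      ≡⟨ K.zeroˡ (K.fromℚ (B (n ∸ j))) ⟩
    K.0# ∎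
  revise : ∀ l → l ≤ n ∸ i →
    term (i ℕ.+ l) ≡ fromℕ (n C i) K.* (fromℕ ((n ∸ i) C l) K.* K.fromℚ (B (n ∸ i ∸ l)))
  revise l l≤n∸i = begin
    fromℕ (n C (i ℕ.+ l)) K.* fromℕ ((i ℕ.+ l) C i) K.* K.fromℚ (B (n ∸ (i ℕ.+ l)))
      ≡⟨ cong₂ (λ c b → c K.* K.fromℚ (B b)) (sym (fromℕ-homo-* (n C (i ℕ.+ l)) ((i ℕ.+ l) C i)))
                                              (sym (ℕP.∸-+-assoc n i l)) ⟩
    fromℕ ((n C (i ℕ.+ l)) ℕ.* ((i ℕ.+ l) C i)) K.* K.fromℚ (B (n ∸ i ∸ l))
      ≡⟨ cong (λ c → fromℕ c K.* K.fromℚ (B (n ∸ i ∸ l))) (nC[i+l]*[i+l]Ci≡nCi*[n∸i]Cl i l i+l≤n) ⟩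
    fromℕ ((n C i) ℕ.* ((n ∸ i) C l)) K.* K.fromℚ (B (n ∸ i ∸ l))
      ≡⟨ cong (K._* K.fromℚ (B (n ∸ i ∸ l))) (fromℕ-homo-* (n C i) ((n ∸ i) C l)) ⟩
    fromℕ (n C i) K.* fromℕ ((n ∸ i) C l) K.* K.fromℚ (B (n ∸ i ∸ l))
      ≡⟨ K.*-assoc (fromℕ (n C i)) (fromℕ ((n ∸ i) C l)) (K.fromℚ (B (n ∸ i ∸ l))) ⟩
    fromℕ (n C i) K.* (fromℕ ((n ∸ i) C l) K.* K.fromℚ (B (n ∸ i ∸ l))) ∎
    where
    i+l≤n : i ℕ.+ l ≤ n
    i+l≤n = subst (i ℕ.+ l ≤_) (ℕP.m+[n∸m]≡n i≤n) (ℕP.+-monoʳ-≤ i l≤n∸i)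

bernoulliPoly-shift : ∀ n x →
  bernoulliPoly n (x K.+ K.1#) ≡ bernoulliPoly n x K.+ ∑ (suc n) (λ i → fromℕ (n C i) K.* x K.^ i K.* δ₁ (n ∸ i))
bernoulliPoly-shift n x = begin
  ∑ N (λ j → fromℕ (n C j) K.* (x K.+ K.1#) K.^ j K.* b j)
    ≡⟨ ∑-cong N (λ j j<N → expand j (ℕP.≤-pred j<N)) ⟩
  ∑ N (λ j → ∑ N (λ i → coeff i j K.* x K.^ i))
    ≡⟨ ∑-comm N N (λ j i → coeff i j K.* x K.^ i) ⟩
  ∑ N (λ i → ∑ N (λ j → coeff i j K.* x K.^ i))
    ≡⟨ ∑-cong N (λ i i<N → trans (sym (*-distribʳ-∑ N (x K.^ i) (λ j → coeff i j)))
                                  (cong (K._* x K.^ i) (∑-C-C-B (ℕP.≤-pred i<N)))) ⟩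
  ∑ N (λ i → fromℕ (n C i) K.* (b i K.+ δ₁ (n ∸ i)) K.* x K.^ i)
    ≡⟨ ∑-cong N (λ i _ → solve 4 (λ c b d p → c :* (b :+ d) :* p := c :* p :* b :+ c :* p :* d)
                                   refl (fromℕ (n C i)) (b i) (δ₁ (n ∸ i)) (x K.^ i)) ⟩
  ∑ N (λ i → fromℕ (n C i) K.* x K.^ i K.* b i K.+ fromℕ (n C i) K.* x K.^ i K.* δ₁ (n ∸ i))
    ≡⟨ ∑-distrib-+ N _ _ ⟩
  bernoulliPoly n x K.+ ∑ N (λ i → fromℕ (n C i) K.* x K.^ i K.* δ₁ (n ∸ i)) ∎
  where
  open ≡-Reasoning
  open K-Solver using (solve; _:=_; _:+_; _:*_)
  N = suc n
  b : ℕ → ℚ[√-3]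
  b j = K.fromℚ (B (n ∸ j))
  coeff : ℕ → ℕ → ℚ[√-3]
  coeff i j = fromℕ (n C j) K.* fromℕ (j C i) K.* b j
  binomialTerm : ℕ → ℕ → ℚ[√-3]
  binomialTerm j i = fromℕ (j C i) K.* x K.^ i
  binomial-padded : ∀ j → j ≤ n → ∑ (suc j) (binomialTerm j) ≡ ∑ N (binomialTerm j)
  binomial-padded j j≤n = begin
    ∑ (suc j) (binomialTerm j)              ≡⟨ ∑-drop-trailing-zeros (suc j) (n ∸ j) (binomialTerm j) beyond-j ⟨
    ∑ (suc j ℕ.+ (n ∸ j)) (binomialTerm j)  ≡⟨ cong (λ t → ∑ (suc t) (binomialTerm j)) (ℕP.m+[n∸m]≡n j≤n) ⟩
    ∑ N (binomialTerm j)                    ∎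
    where
    beyond-j : ∀ i → suc j ≤ i → binomialTerm j i ≡ K.0#
    beyond-j i j<i = trans (cong (λ c → fromℕ c K.* x K.^ i) (k>n⇒nCk≡0 j<i)) (K.zeroˡ (x K.^ i))
  expand : ∀ j → j ≤ n → fromℕ (n C j) K.* (x K.+ K.1#) K.^ j K.* b j ≡ ∑ N (λ i → coeff i j K.* x K.^ i)
  expand j j≤n = begin
    fromℕ (n C j) K.* (x K.+ K.1#) K.^ j K.* b j
      ≡⟨ cong (λ p → fromℕ (n C j) K.* p K.* b j) (trans (binomial-theorem j x) (binomial-padded j j≤n)) ⟩
    fromℕ (n C j) K.* ∑ N (binomialTerm j) K.* b j
      ≡⟨ trans (cong (K._* b j) (*-distribˡ-∑ N (fromℕ (n C j)) (binomialTerm j)))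
               (*-distribʳ-∑ N (b j) (λ i → fromℕ (n C j) K.* binomialTerm j i)) ⟩
    ∑ N (λ i → fromℕ (n C j) K.* (fromℕ (j C i) K.* x K.^ i) K.* b j)
      ≡⟨ ∑-cong N (λ i _ → solve 4 (λ c c′ p b → c :* (c′ :* p) :* b := c :* c′ :* b :* p)
                                     refl (fromℕ (n C j)) (fromℕ (j C i)) (x K.^ i) (b j)) ⟩
    ∑ N (λ i → coeff i j K.* x K.^ i) ∎

private
  δ₁[1+m∸i]≡0 : ∀ {m i} → i ℕ.< m → δ₁ (suc m ∸ i) ≡ K.0#
  δ₁[1+m∸i]≡0 {suc m} {zero}  _         = refl
  δ₁[1+m∸i]≡0 {suc m} {suc i} (s≤s i<m) = δ₁[1+m∸i]≡0 i<m

bernoulliPoly-step : ∀ m x →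
  bernoulliPoly (suc m) (x K.+ K.1#) ≡ bernoulliPoly (suc m) x K.+ fromℕ (suc m) K.* x K.^ m
bernoulliPoly-step m x = trans (bernoulliPoly-shift (suc m) x) (cong (bernoulliPoly (suc m) x K.+_) δ-part)
  where
  open ≡-Reasoning
  term : ℕ → ℚ[√-3]
  term i = fromℕ (suc m C i) K.* x K.^ i K.* δ₁ (suc m ∸ i)
  early : ∀ i → i ℕ.< m → term i ≡ K.0#
  early i i<m = trans (cong (fromℕ (suc m C i) K.* x K.^ i K.*_) (δ₁[1+m∸i]≡0 i<m))
                      (K.zeroʳ (fromℕ (suc m C i) K.* x K.^ i))
  last : term (suc m) ≡ K.0#
  last = trans (cong (λ t → fromℕ (suc m C suc m) K.* x K.^ suc m K.* δ₁ t) (ℕP.n∸n≡0 m))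
               (K.zeroʳ (fromℕ (suc m C suc m) K.* x K.^ suc m))
  penultimate : term m ≡ fromℕ (suc m) K.* x K.^ m
  penultimate = begin
    fromℕ (suc m C m) K.* x K.^ m K.* δ₁ (suc m ∸ m)
      ≡⟨ cong₂ (λ c t → fromℕ c K.* x K.^ m K.* δ₁ t) ([1+n]Cn≡1+n m) (ℕP.m+n∸n≡m 1 m) ⟩
    fromℕ (suc m) K.* x K.^ m K.* K.1#
      ≡⟨ K.*-identityʳ _ ⟩
    fromℕ (suc m) K.* x K.^ m ∎
  δ-part : ∑ (suc (suc m)) term ≡ fromℕ (suc m) K.* x K.^ m
  δ-part = begin
    ∑ m term K.+ term m K.+ term (suc m)   ≡⟨ cong₂ (λ s t → s K.+ term m K.+ t) (∑-zero m early) last ⟩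
    K.0# K.+ term m K.+ K.0#               ≡⟨ trans (K.+-identityʳ _) (K.+-identityˡ _) ⟩
    term m                                 ≡⟨ penultimate ⟩
    fromℕ (suc m) K.* x K.^ m              ∎

powerSum : ℕ → ℚ[√-3] → ℕ → ℚ[√-3]
powerSum m x j = ∑ j (λ t → fromℕ (suc m) K.* (x K.+ fromℕ t) K.^ m)

bernoulliPoly-telescope : ∀ m x j →
  bernoulliPoly (suc m) (x K.+ fromℕ j) ≡ bernoulliPoly (suc m) x K.+ powerSum m x j
bernoulliPoly-telescope m x zero    = trans (cong (bernoulliPoly (suc m)) (K.+-identityʳ x)) (sym (K.+-identityʳ _))
bernoulliPoly-telescope m x (suc j) = begin
  bernoulliPoly (suc m) (x K.+ fromℕ (suc j))
    ≡⟨ cong (λ t → bernoulliPoly (suc m) (x K.+ t)) (trans (fromℕ-homo-+ 1 j) (K.+-comm K.1# (fromℕ j))) ⟩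
  bernoulliPoly (suc m) (x K.+ (fromℕ j K.+ K.1#))
    ≡⟨ cong (bernoulliPoly (suc m)) (K.+-assoc x (fromℕ j) K.1#) ⟨
  bernoulliPoly (suc m) (x K.+ fromℕ j K.+ K.1#)
    ≡⟨ bernoulliPoly-step m (x K.+ fromℕ j) ⟩
  bernoulliPoly (suc m) (x K.+ fromℕ j) K.+ increment j
    ≡⟨ cong (K._+ increment j) (bernoulliPoly-telescope m x j) ⟩
  bernoulliPoly (suc m) x K.+ ∑ j increment K.+ increment j
    ≡⟨ K.+-assoc (bernoulliPoly (suc m) x) (∑ j increment) (increment j) ⟩
  bernoulliPoly (suc m) x K.+ ∑ (suc j) increment ∎
  where
  open ≡-Reasoning
  increment : ℕ → ℚ[√-3]
  increment t = fromℕ (suc m) K.* (x K.+ fromℕ t) K.^ m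

-- Filtering exponents by sixth roots of unity

ζ : ℚ[√-3]
ζ = ⟨ + 1 ℚ./ 2 , + 1 ℚ./ 2 ⟩

point : ℕ → ℚ[√-3]
point j = fromℕ 4 K.* ζ K.^ j

sign : ℕ → ℚ[√-3]
sign j = (K.- K.1#) K.^ j

-- sign j K.* point j K.^ k = 4ᵏ ζ^(j(k+3)) because ζ³ = −1.
filterSum : ℕ → ℚ[√-3]
filterSum k = ∑ 6 (λ j → sign j K.* point j K.^ k)

threeMod6ᵇ : ℕ → Bool
threeMod6ᵇ k = does (+ 6 ∣? (+ k - + 3))

𝟙 : Bool → ℚ[√-3]
𝟙 b = if b then K.1# else K.0#

threeMod6ᵇ-periodic : ∀ k → threeMod6ᵇ (6 ℕ.+ k) ≡ threeMod6ᵇ k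
threeMod6ᵇ-periodic k = does-⇔
  (mk⇔ (λ 6∣6+z → ℤD.∣m+n∣m⇒∣n (subst (+ 6 ℤD.∣_) shift 6∣6+z) ℤD.∣-refl)
       (λ 6∣z → subst (+ 6 ℤD.∣_) (sym shift) (ℤD.∣m∣n⇒∣m+n ℤD.∣-refl 6∣z)))
  (+ 6 ∣? (+ (6 ℕ.+ k) - + 3)) (+ 6 ∣? (+ k - + 3))
  where
  shift : + (6 ℕ.+ k) - + 3 ≡ + 6 ℤ.+ (+ k - + 3)
  shift = trans (cong (_- + 3) (ℤP.pos-+ 6 k)) (ℤP.+-assoc (+ 6) (+ k) (- + 3))

point⁶≡4096 : ∀ j → point j K.^ 6 ≡ fromℕ 4096
point⁶≡4096 j = begin
  (fromℕ 4 K.* ζ K.^ j) K.^ 6      ≡⟨ K.^-distrib-* (fromℕ 4) (ζ K.^ j) 6 ⟩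
  fromℕ 4096 K.* (ζ K.^ j) K.^ 6   ≡⟨ cong (fromℕ 4096 K.*_) ζʲ⁶≡1 ⟩
  fromℕ 4096 K.* K.1#              ≡⟨ K.*-identityʳ (fromℕ 4096) ⟩
  fromℕ 4096                       ∎
  where
  open ≡-Reasoning
  ζʲ⁶≡1 : (ζ K.^ j) K.^ 6 ≡ K.1#
  ζʲ⁶≡1 = begin
    (ζ K.^ j) K.^ 6    ≡⟨ K.^-assocʳ ζ j 6 ⟩
    ζ K.^ (j ℕ.* 6)    ≡⟨ cong (ζ K.^_) (ℕP.*-comm j 6) ⟩
    ζ K.^ (6 ℕ.* j)    ≡⟨ K.^-assocʳ ζ 6 j ⟨
    K.1# K.^ j         ≡⟨ 1^n≡1 j ⟩
    K.1#               ∎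

filterSum-sixfold : ∀ k → filterSum (6 ℕ.+ k) ≡ fromℕ 4096 K.* filterSum k
filterSum-sixfold k = trans (∑-cong 6 (λ j _ → factor j))
                            (sym (*-distribˡ-∑ 6 (fromℕ 4096) (λ j → sign j K.* point j K.^ k)))
  where
  open K-Solver using (solve; _:=_; _:*_)
  factor : ∀ j → sign j K.* point j K.^ (6 ℕ.+ k) ≡ fromℕ 4096 K.* (sign j K.* point j K.^ k)
  factor j = trans
    (cong (sign j K.*_) (trans (K.^-homo-* (point j) 6 k) (cong (K._* point j K.^ k) (point⁶≡4096 j))))
    (solve 3 (λ s c p → s :* (c :* p) := c :* (s :* p)) refl (sign j) (fromℕ 4096) (point j K.^ k))

sixth-roots-filter : ∀ k → filterSum k ≡ 𝟙 (threeMod6ᵇ k) K.* (fromℕ 6 K.* fromℕ 4 K.^ k)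
sixth-roots-filter 0 = refl
sixth-roots-filter 1 = refl
sixth-roots-filter 2 = refl
sixth-roots-filter 3 = refl
sixth-roots-filter 4 = refl
sixth-roots-filter 5 = refl
sixth-roots-filter (suc (suc (suc (suc (suc (suc k)))))) = begin
  filterSum (6 ℕ.+ k)
    ≡⟨ filterSum-sixfold k ⟩
  fromℕ 4096 K.* filterSum k
    ≡⟨ cong (fromℕ 4096 K.*_) (sixth-roots-filter k) ⟩
  fromℕ 4096 K.* (𝟙 (threeMod6ᵇ k) K.* (fromℕ 6 K.* fromℕ 4 K.^ k))
    ≡⟨ solve 2 (λ i p → con (fromℕ 4096) :* (i :* (con (fromℕ 6) :* p))
                     := i :* (con (fromℕ 6) :* (con (fromℕ 4 K.^ 6) :* p)))
               refl (𝟙 (threeMod6ᵇ k)) (fromℕ 4 K.^ k) ⟩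
  𝟙 (threeMod6ᵇ k) K.* (fromℕ 6 K.* (fromℕ 4 K.^ 6 K.* fromℕ 4 K.^ k))
    ≡⟨ cong₂ (λ b p → 𝟙 b K.* (fromℕ 6 K.* p)) (threeMod6ᵇ-periodic k) (K.^-homo-* (fromℕ 4) 6 k) ⟨
  𝟙 (threeMod6ᵇ (6 ℕ.+ k)) K.* (fromℕ 6 K.* fromℕ 4 K.^ (6 ℕ.+ k)) ∎
  where
  open ≡-Reasoning
  open K-Solver using (solve; _:=_; _:*_; con)

fromℚ-if : ∀ b q → K.fromℚ (if b then q else 0ℚ) ≡ 𝟙 b K.* K.fromℚ q
fromℚ-if true  q = sym (K.*-identityˡ (K.fromℚ q))
fromℚ-if false q = sym (K.zeroˡ (K.fromℚ q))

lhs-filtered : ∀ n → K.fromℚ (lhs n) K.* fromℕ 6 ≡ ∑ 6 (λ j → sign j K.* bernoulliPoly n (point j))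
lhs-filtered n = begin
  K.fromℚ (lhs n) K.* fromℕ 6
    ≡⟨ cong (K._* fromℕ 6) (fromℚ-sumTo n term) ⟩
  ∑ (suc n) (K.fromℚ ∘ term) K.* fromℕ 6
    ≡⟨ *-distribʳ-∑ (suc n) (fromℕ 6) (K.fromℚ ∘ term) ⟩
  ∑ (suc n) (λ k → K.fromℚ (term k) K.* fromℕ 6)
    ≡⟨ ∑-cong (suc n) (λ k _ → term-filtered k) ⟩
  ∑ (suc n) (λ k → ∑ 6 (λ j → sign j K.* monomial j k))
    ≡⟨ ∑-comm (suc n) 6 (λ k j → sign j K.* monomial j k) ⟩
  ∑ 6 (λ j → ∑ (suc n) (λ k → sign j K.* monomial j k))
    ≡⟨ ∑-cong 6 (λ j _ → *-distribˡ-∑ (suc n) (sign j) (monomial j)) ⟨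
  ∑ 6 (λ j → sign j K.* bernoulliPoly n (point j)) ∎
  where
  open ≡-Reasoning
  open K-Solver using (solve; _:=_; _:*_; con)
  term : ℕ → ℚ
  term k = if threeMod6ᵇ k then ℕtoℚ (n C k) ℚ.* ℕtoℚ (4 ℕ.^ k) ℚ.* B (n ∸ k) else 0ℚ
  monomial : ℕ → ℕ → ℚ[√-3]
  monomial j k = fromℕ (n C k) K.* point j K.^ k K.* K.fromℚ (B (n ∸ k))
  term-filtered : ∀ k → K.fromℚ (term k) K.* fromℕ 6 ≡ ∑ 6 (λ j → sign j K.* monomial j k)
  term-filtered k = begin
    K.fromℚ (term k) K.* fromℕ 6
      ≡⟨ cong (K._* fromℕ 6) (fromℚ-if (threeMod6ᵇ k) _) ⟩
    𝟙 (threeMod6ᵇ k) K.* K.fromℚ (ℕtoℚ (n C k) ℚ.* ℕtoℚ (4 ℕ.^ k) ℚ.* B (n ∸ k)) K.* fromℕ 6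
      ≡⟨ cong (λ t → 𝟙 (threeMod6ᵇ k) K.* t K.* fromℕ 6) embed ⟩
    𝟙 (threeMod6ᵇ k) K.* (c K.* fromℕ 4 K.^ k K.* b) K.* fromℕ 6
      ≡⟨ solve 4 (λ i c p b → i :* (c :* p :* b) :* con (fromℕ 6) := c :* (i :* (con (fromℕ 6) :* p)) :* b)
                 refl (𝟙 (threeMod6ᵇ k)) c (fromℕ 4 K.^ k) b ⟩
    c K.* (𝟙 (threeMod6ᵇ k) K.* (fromℕ 6 K.* fromℕ 4 K.^ k)) K.* b
      ≡⟨ cong (λ t → c K.* t K.* b) (sixth-roots-filter k) ⟨
    c K.* ∑ 6 (λ j → sign j K.* point j K.^ k) K.* b
      ≡⟨ trans (cong (K._* b) (*-distribˡ-∑ 6 c filterTerm)) (*-distribʳ-∑ 6 b (λ j → c K.* filterTerm j)) ⟩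
    ∑ 6 (λ j → c K.* (sign j K.* point j K.^ k) K.* b)
      ≡⟨ ∑-cong 6 (λ j _ → solve 4 (λ c s p b → c :* (s :* p) :* b := s :* (c :* p :* b))
                                   refl c (sign j) (point j K.^ k) b) ⟩
    ∑ 6 (λ j → sign j K.* monomial j k) ∎
    where
    c b : ℚ[√-3]
    c = fromℕ (n C k)
    b = K.fromℚ (B (n ∸ k))
    filterTerm : ℕ → ℚ[√-3]
    filterTerm j = sign j K.* point j K.^ k
    embed : K.fromℚ (ℕtoℚ (n C k) ℚ.* ℕtoℚ (4 ℕ.^ k) ℚ.* B (n ∸ k)) ≡ c K.* fromℕ 4 K.^ k K.* b
    embed = trans (K.fromℚ-homo-* (ℕtoℚ (n C k) ℚ.* ℕtoℚ (4 ℕ.^ k)) (B (n ∸ k))) (cong (K._* b)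
      (trans (K.fromℚ-homo-* (ℕtoℚ (n C k)) (ℕtoℚ (4 ℕ.^ k))) (cong (c K.*_) (fromℕ-homo-^ 4 k))))

-- point 0 = point 3 + 8, point 1 = point 2 + 4 and point 5 = point 4 + 4 hold by evaluation.
lhs-telescoped : ∀ m → K.fromℚ (lhs (suc m)) K.* fromℕ 6
  ≡ powerSum m (point 3) 8 K.- powerSum m (point 2) 4 K.- powerSum m (point 4) 4
lhs-telescoped m = begin
  K.fromℚ (lhs (suc m)) K.* fromℕ 6
    ≡⟨ lhs-filtered (suc m) ⟩
  alternating (P 0) (P 1) (P 5)
    ≡⟨ trans (cong₂ (λ p₀ p₁ → alternating p₀ p₁ (P 5)) (bernoulliPoly-telescope m (point 3) 8)
                                                         (bernoulliPoly-telescope m (point 2) 4))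
             (cong (alternating (P 3 K.+ powerSum m (point 3) 8) (P 2 K.+ powerSum m (point 2) 4))
                   (bernoulliPoly-telescope m (point 4) 4)) ⟩
  alternating (P 3 K.+ powerSum m (point 3) 8) (P 2 K.+ powerSum m (point 2) 4) (P 4 K.+ powerSum m (point 4) 4)
    ≡⟨ solve 6 (λ p₂ p₃ p₄ s₁ s₂ s₃ →
         con K.0# :+ con (sign 0) :* (p₃ :+ s₁) :+ con (sign 1) :* (p₂ :+ s₂) :+ con (sign 2) :* p₂
                  :+ con (sign 3) :* p₃ :+ con (sign 4) :* p₄ :+ con (sign 5) :* (p₄ :+ s₃)
         := s₁ :- s₂ :- s₃)
         refl (P 2) (P 3) (P 4) (powerSum m (point 3) 8) (powerSum m (point 2) 4) (powerSum m (point 4) 4) ⟩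
  powerSum m (point 3) 8 K.- powerSum m (point 2) 4 K.- powerSum m (point 4) 4 ∎
  where
  open ≡-Reasoning
  open K-Solver using (solve; _:=_; _:+_; _:-_; _:*_; con)
  P : ℕ → ℚ[√-3]
  P j = bernoulliPoly (suc m) (point j)
  alternating : ℚ[√-3] → ℚ[√-3] → ℚ[√-3] → ℚ[√-3]
  alternating p₀ p₁ p₅ = K.0# K.+ sign 0 K.* p₀ K.+ sign 1 K.* p₁ K.+ sign 2 K.* P 2
                              K.+ sign 3 K.* P 3 K.+ sign 4 K.* P 4 K.+ sign 5 K.* p₅

-- Cube roots of unity and the Lucas sequence V(2,13)

ω ω̄ : ℚ[√-3]
ω = ζ K.^ 2
ω̄ = ζ K.^ 4

xⁿ≡1⇒xᵏ≡x^[k%n] : ∀ {x} n .{{_ : ℕ.NonZero n}} → x K.^ n ≡ K.1# → ∀ k → x K.^ k ≡ x K.^ (k % n)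
xⁿ≡1⇒xᵏ≡x^[k%n] {x} n xⁿ≡1 k = begin
  x K.^ k                                  ≡⟨ cong (x K.^_) (ℕDM.m≡m%n+[m/n]*n k n) ⟩
  x K.^ (k % n ℕ.+ k / n ℕ.* n)            ≡⟨ K.^-homo-* x (k % n) (k / n ℕ.* n) ⟩
  x K.^ (k % n) K.* x K.^ (k / n ℕ.* n)    ≡⟨ cong (x K.^ (k % n) K.*_) x^[qn]≡1 ⟩
  x K.^ (k % n) K.* K.1#                   ≡⟨ K.*-identityʳ (x K.^ (k % n)) ⟩
  x K.^ (k % n)                            ∎
  where
  open ≡-Reasoning
  x^[qn]≡1 : x K.^ (k / n ℕ.* n) ≡ K.1#
  x^[qn]≡1 = begin
    x K.^ (k / n ℕ.* n)   ≡⟨ cong (x K.^_) (ℕP.*-comm (k / n) n) ⟩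
    x K.^ (n ℕ.* (k / n)) ≡⟨ K.^-assocʳ x n (k / n) ⟨
    (x K.^ n) K.^ (k / n) ≡⟨ cong (K._^ (k / n)) xⁿ≡1 ⟩
    K.1# K.^ (k / n)      ≡⟨ 1^n≡1 (k / n) ⟩
    K.1#                  ∎

ω^h+ω̄^h≡ω^[h%3]+ω̄^[h%3] : ∀ h → ω K.^ h K.+ ω̄ K.^ h ≡ ω K.^ (h % 3) K.+ ω̄ K.^ (h % 3)
ω^h+ω̄^h≡ω^[h%3]+ω̄^[h%3] h = cong₂ K._+_ (xⁿ≡1⇒xᵏ≡x^[k%n] 3 refl h) (xⁿ≡1⇒xᵏ≡x^[k%n] 3 refl h)

ω^h+ω̄^h≡2 : ∀ {h} → 3 ℕD.∣ h → ω K.^ h K.+ ω̄ K.^ h ≡ fromℕ 2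
ω^h+ω̄^h≡2 {h} 3∣h = trans (ω^h+ω̄^h≡ω^[h%3]+ω̄^[h%3] h)
                           (cong (λ r → ω K.^ r K.+ ω̄ K.^ r) (ℕD.n∣m⇒m%n≡0 h 3 3∣h))

ω^h+ω̄^h≡-1 : ∀ {h} → ¬ 3 ℕD.∣ h → ω K.^ h K.+ ω̄ K.^ h ≡ K.- K.1#
ω^h+ω̄^h≡-1 {h} 3∤h = trans (ω^h+ω̄^h≡ω^[h%3]+ω̄^[h%3] h)
  (nonzero-residue (h % 3) (ℕDM.m%n<n h 3) (λ h%3≡0 → 3∤h (ℕD.m%n≡0⇒n∣m h 3 h%3≡0)))
  where
  nonzero-residue : ∀ r → r ℕ.< 3 → ¬ r ≡ 0 → ω K.^ r K.+ ω̄ K.^ r ≡ K.- K.1#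
  nonzero-residue 0 _ r≢0 = contradiction refl r≢0
  nonzero-residue 1 _ _   = refl
  nonzero-residue 2 _ _   = refl
  nonzero-residue (suc (suc (suc _))) (s≤s (s≤s (s≤s ()))) _

lucas-binet : ∀ {b c} x y → fromℤ b ≡ x K.+ y → fromℤ c ≡ x K.* y →
  ∀ k → fromℤ (V k b c) ≡ x K.^ k K.+ y K.^ k
lucas-binet x y b≡x+y c≡xy zero          = refl
lucas-binet x y b≡x+y c≡xy (suc zero)    = trans b≡x+y (sym (cong₂ K._+_ (K.*-identityʳ x) (K.*-identityʳ y)))
lucas-binet {b} {c} x y b≡x+y c≡xy (suc (suc k)) = begin
  fromℤ (b ℤ.* V (suc k) b c - c ℤ.* V k b c)
    ≡⟨ trans (fromℤ-homo-- (b ℤ.* V (suc k) b c) (c ℤ.* V k b c))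
             (cong₂ K._-_ (fromℤ-homo-* b (V (suc k) b c)) (fromℤ-homo-* c (V k b c))) ⟩
  fromℤ b K.* fromℤ (V (suc k) b c) K.- fromℤ c K.* fromℤ (V k b c)
    ≡⟨ cong₂ (λ u v → u K.- v) (cong₂ K._*_ b≡x+y (lucas-binet x y b≡x+y c≡xy (suc k)))
                              (cong₂ K._*_ c≡xy (lucas-binet x y b≡x+y c≡xy k)) ⟩
  (x K.+ y) K.* (x K.* x K.^ k K.+ y K.* y K.^ k) K.- x K.* y K.* (x K.^ k K.+ y K.^ k)
    ≡⟨ solve 4 (λ x y xᵏ yᵏ → (x :+ y) :* (x :* xᵏ :+ y :* yᵏ) :- x :* y :* (xᵏ :+ yᵏ)
                           := x :* (x :* xᵏ) :+ y :* (y :* yᵏ))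
               refl x y (x K.^ k) (y K.^ k) ⟩
  x K.^ suc (suc k) K.+ y K.^ suc (suc k) ∎
  where
  open ≡-Reasoning
  open K-Solver using (solve; _:=_; _:+_; _:-_; _:*_)

-- α, β = 1 ± 2√-3 are the roots of X² − 2X + 13.
α β : ℚ[√-3]
α = ⟨ 1ℚ , + 2 ℚ./ 1 ⟩
β = ⟨ 1ℚ , ℚ.- (+ 2 ℚ./ 1) ⟩

-- Evaluation for odd n = 2h + 1

suc[2*[1+m]∸3]≡m+m : ∀ {m} → 1 ≤ m → suc (2 ℕ.* suc m ∸ 3) ≡ m ℕ.+ m
suc[2*[1+m]∸3]≡m+m {suc k} _ =
  cong suc (trans (cong (_∸ 3) (2*[2+k]≡[k+[1+k]]+3 k)) (ℕP.m+n∸n≡m (k ℕ.+ suc k) 3))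
  where
  2*[2+k]≡[k+[1+k]]+3 : ∀ k → 2 ℕ.* suc (suc k) ≡ k ℕ.+ suc k ℕ.+ 3
  2*[2+k]≡[k+[1+k]]+3 = ℕ-Solver.solve-∀

module _ {m h : ℕ} (m≡h+h : m ≡ h ℕ.+ h) where

  private
    N P Y W S : ℚ[√-3]
    N = fromℕ (suc m)
    P = K.1# K.+ fromℕ 4 K.^ h K.+ fromℕ 9 K.^ h
    Y = fromℤ (- + 12) K.^ h
    W = (α K.* α) K.^ h K.+ (β K.* β) K.^ h
    S = fromℕ 16 K.^ h

    closedForm : ℚ[√-3] → ℚ[√-3] → ℚ[√-3]
    closedForm s c = N K.* (fromℕ 2 K.* (P K.- Y K.- W) K.+ s K.- s K.* c)

    squareSum : ℚ[√-3] → ℕ → ℚ[√-3]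
    squareSum x j = ∑ j (λ t → N K.* ((x K.+ fromℕ t) K.* (x K.+ fromℕ t)) K.^ h)

  x^m≡[x*x]^h : ∀ x → x K.^ m ≡ (x K.* x) K.^ h
  x^m≡[x*x]^h x = begin
    x K.^ m               ≡⟨ cong (x K.^_) m≡h+h ⟩
    x K.^ (h ℕ.+ h)       ≡⟨ K.^-homo-* x h h ⟩
    x K.^ h K.* x K.^ h   ≡⟨ K.^-distrib-* x x h ⟨
    (x K.* x) K.^ h       ∎
    where open ≡-Reasoning

  powerSum≡squareSum : ∀ x j → powerSum m x j ≡ squareSum x j
  powerSum≡squareSum x j = ∑-cong j (λ t _ → cong (N K.*_) (x^m≡[x*x]^h (x K.+ fromℕ t)))

  lhs-closed-form : 1 ≤ h → K.fromℚ (lhs (suc m)) K.* fromℕ 6 ≡ closedForm S (ω K.^ h K.+ ω̄ K.^ h)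
  lhs-closed-form (s≤s {n = h-1} _) = begin
    K.fromℚ (lhs (suc m)) K.* fromℕ 6
      ≡⟨ lhs-telescoped m ⟩
    powerSum m (point 3) 8 K.- powerSum m (point 2) 4 K.- powerSum m (point 4) 4
      ≡⟨ cong₂ K._-_ (cong₂ K._-_ (powerSum≡squareSum (point 3) 8) (powerSum≡squareSum (point 2) 4))
                     (powerSum≡squareSum (point 4) 4) ⟩
    squareSum (point 3) 8 K.- squareSum (point 2) 4 K.- squareSum (point 4) 4
      -- the squares evaluate to (t − 4)² for point 3, to 16ω̄, β², −12, α² for point 2
      -- and to 16ω, α², −12, β² for point 4
      ≡⟨ solve 11 (λ n a₁₆ a₉ a₄ a₁ a₀ aω aω̄ aα aβ a₁₂ →
           (con K.0# :+ n :* a₁₆ :+ n :* a₉ :+ n :* a₄ :+ n :* a₁ :+ n :* a₀ :+ n :* a₁ :+ n :* a₄ :+ n :* a₉)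
           :- (con K.0# :+ n :* aω̄ :+ n :* aβ :+ n :* a₁₂ :+ n :* aα)
           :- (con K.0# :+ n :* aω :+ n :* aα :+ n :* a₁₂ :+ n :* aβ)
           := n :* (con (fromℕ 2) :* (a₁ :+ a₄ :+ a₉ :- a₁₂ :- (aα :+ aβ)) :+ a₁₆ :+ a₀ :- (aω :+ aω̄)))
           refl N S (fromℕ 9 K.^ h) (fromℕ 4 K.^ h) (K.1# K.^ h) (K.0# K.^ h)
                ((fromℕ 16 K.* ω) K.^ h) ((fromℕ 16 K.* ω̄) K.^ h) ((α K.* α) K.^ h) ((β K.* β) K.^ h) Y ⟩
    shape (K.1# K.^ h) (K.0# K.^ h) ((fromℕ 16 K.* ω) K.^ h) ((fromℕ 16 K.* ω̄) K.^ h)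
      ≡⟨ cong₂ (λ o z → shape o z ((fromℕ 16 K.* ω) K.^ h) ((fromℕ 16 K.* ω̄) K.^ h))
               (1^n≡1 h) (K.zeroˡ (K.0# K.^ h-1)) ⟩
    shape K.1# K.0# ((fromℕ 16 K.* ω) K.^ h) ((fromℕ 16 K.* ω̄) K.^ h)
      ≡⟨ cong₂ (shape K.1# K.0#) (K.^-distrib-* (fromℕ 16) ω h) (K.^-distrib-* (fromℕ 16) ω̄ h) ⟩
    shape K.1# K.0# (S K.* ω K.^ h) (S K.* ω̄ K.^ h)
      ≡⟨ solve 8 (λ n a₄ a₉ y w s u v →
           n :* (con (fromℕ 2) :* (con K.1# :+ a₄ :+ a₉ :- y :- w) :+ s :+ con K.0# :- (s :* u :+ s :* v))
           := n :* (con (fromℕ 2) :* (con K.1# :+ a₄ :+ a₉ :- y :- w) :+ s :- s :* (u :+ v)))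
           refl N (fromℕ 4 K.^ h) (fromℕ 9 K.^ h) Y W S (ω K.^ h) (ω̄ K.^ h) ⟩
    closedForm S (ω K.^ h K.+ ω̄ K.^ h) ∎
    where
    open ≡-Reasoning
    open K-Solver using (solve; _:=_; _:+_; _:-_; _:*_; con)
    shape : ℚ[√-3] → ℚ[√-3] → ℚ[√-3] → ℚ[√-3] → ℚ[√-3]
    shape o z u v =
      N K.* (fromℕ 2 K.* (o K.+ fromℕ 4 K.^ h K.+ fromℕ 9 K.^ h K.- Y K.- W) K.+ S K.+ z K.- (u K.+ v))

  rhs₁ rhs₂ : ℤ
  rhs₁ = + 1 ℤ.+ (+ 2) ^ m ℤ.+ (+ 3) ^ m - (+ 2) ^ (2 ℕ.* suc m ∸ 3) - (- (+ 12)) ^ h - V m (+ 2) (+ 13)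
  rhs₂ = + 1 ℤ.+ (+ 2) ^ m ℤ.+ (+ 3) ^ m ℤ.+ (+ 4) ^ m - (- (+ 12)) ^ h - V m (+ 2) (+ 13)

  private
    1+2^m+3^m 2^[2n-3] : ℤ
    1+2^m+3^m = + 1 ℤ.+ (+ 2) ^ m ℤ.+ (+ 3) ^ m
    2^[2n-3]  = (+ 2) ^ (2 ℕ.* suc m ∸ 3)

    fromℤ-^m : ∀ z → fromℤ (z ^ m) ≡ (fromℤ z K.* fromℤ z) K.^ h
    fromℤ-^m z = trans (fromℤ-homo-^ z m) (x^m≡[x*x]^h (fromℤ z))

    fromℤ-1+2^m+3^m : fromℤ 1+2^m+3^m ≡ P
    fromℤ-1+2^m+3^m = trans (fromℤ-homo-+ (+ 1 ℤ.+ (+ 2) ^ m) ((+ 3) ^ m))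
      (cong₂ K._+_ (trans (fromℤ-homo-+ (+ 1) ((+ 2) ^ m)) (cong (K.1# K.+_) (fromℤ-^m (+ 2)))) (fromℤ-^m (+ 3)))

    fromℤ-[z-[-12]^h-V] : ∀ z → fromℤ (z - (- (+ 12)) ^ h - V m (+ 2) (+ 13)) ≡ fromℤ z K.- Y K.- W
    fromℤ-[z-[-12]^h-V] z = trans (fromℤ-homo-- (z - (- (+ 12)) ^ h) (V m (+ 2) (+ 13))) (cong₂ K._-_
      (trans (fromℤ-homo-- z ((- (+ 12)) ^ h)) (cong (λ y → fromℤ z K.- y) (fromℤ-homo-^ (- (+ 12)) h)))
      (trans (lucas-binet α β refl refl m) (cong₂ K._+_ (x^m≡[x*x]^h α) (x^m≡[x*x]^h β))))

    fromℤ-rhs₁ : fromℤ rhs₁ ≡ P K.- fromℤ 2^[2n-3] K.- Y K.- W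
    fromℤ-rhs₁ = begin
      fromℤ rhs₁
        ≡⟨ fromℤ-[z-[-12]^h-V] (1+2^m+3^m - 2^[2n-3]) ⟩
      fromℤ (1+2^m+3^m - 2^[2n-3]) K.- Y K.- W
        ≡⟨ cong (λ t → t K.- Y K.- W) (fromℤ-homo-- 1+2^m+3^m 2^[2n-3]) ⟩
      fromℤ 1+2^m+3^m K.- fromℤ 2^[2n-3] K.- Y K.- W
        ≡⟨ cong (λ t → t K.- fromℤ 2^[2n-3] K.- Y K.- W) fromℤ-1+2^m+3^m ⟩
      P K.- fromℤ 2^[2n-3] K.- Y K.- W ∎
      where open ≡-Reasoning

    fromℤ-rhs₂ : fromℤ rhs₂ ≡ P K.+ S K.- Y K.- W
    fromℤ-rhs₂ = begin
      fromℤ rhs₂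
        ≡⟨ fromℤ-[z-[-12]^h-V] (1+2^m+3^m ℤ.+ (+ 4) ^ m) ⟩
      fromℤ (1+2^m+3^m ℤ.+ (+ 4) ^ m) K.- Y K.- W
        ≡⟨ cong (λ t → t K.- Y K.- W) (fromℤ-homo-+ 1+2^m+3^m ((+ 4) ^ m)) ⟩
      fromℤ 1+2^m+3^m K.+ fromℤ ((+ 4) ^ m) K.- Y K.- W
        ≡⟨ cong₂ (λ p s → p K.+ s K.- Y K.- W) fromℤ-1+2^m+3^m (fromℤ-^m (+ 4)) ⟩
      P K.+ S K.- Y K.- W ∎
      where open ≡-Reasoning

    S≡2*2^[2n-3] : 1 ≤ h → S ≡ fromℕ 2 K.* fromℤ 2^[2n-3]
    S≡2*2^[2n-3] h≥1 = begin
      fromℕ 16 K.^ h                      ≡⟨ x^m≡[x*x]^h (fromℕ 4) ⟨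
      fromℕ 4 K.^ m                       ≡⟨ K.^-distrib-* (fromℕ 2) (fromℕ 2) m ⟩
      fromℕ 2 K.^ m K.* fromℕ 2 K.^ m     ≡⟨ K.^-homo-* (fromℕ 2) m m ⟨
      fromℕ 2 K.^ (m ℕ.+ m)               ≡⟨ cong (fromℕ 2 K.^_) (suc[2*[1+m]∸3]≡m+m m≥1) ⟨
      fromℕ 2 K.^ suc (2 ℕ.* suc m ∸ 3)   ≡⟨ cong (fromℕ 2 K.*_) (fromℤ-homo-^ (+ 2) (2 ℕ.* suc m ∸ 3)) ⟨
      fromℕ 2 K.* fromℤ 2^[2n-3]          ∎
      where
      open ≡-Reasoning
      m≥1 : 1 ≤ m
      m≥1 = subst (1 ≤_) (sym m≡h+h) (ℕP.≤-trans h≥1 (ℕP.m≤m+n h h))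

  lhs-when-3∣h : 1 ≤ h → 3 ℕD.∣ h → lhs (suc m) ≡ (+ suc m ℚ./ 3) ℚ.* ℤtoℚ rhs₁
  lhs-when-3∣h h≥1 3∣h = x*6≡n*E*2⇒x≡n/3*E (suc m) (lhs (suc m)) rhs₁ (begin
    K.fromℚ (lhs (suc m)) K.* fromℕ 6                 ≡⟨ lhs-closed-form h≥1 ⟩
    closedForm S (ω K.^ h K.+ ω̄ K.^ h)               ≡⟨ cong₂ closedForm (S≡2*2^[2n-3] h≥1) (ω^h+ω̄^h≡2 3∣h) ⟩
    closedForm (fromℕ 2 K.* X) (fromℕ 2)             ≡⟨ solve 5 (λ n p y w x →
        n :* (con (fromℕ 2) :* (p :- y :- w) :+ con (fromℕ 2) :* x :- con (fromℕ 2) :* x :* con (fromℕ 2))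
        := n :* (p :- x :- y :- w) :* con (fromℕ 2)) refl N P Y W X ⟩
    N K.* (P K.- X K.- Y K.- W) K.* fromℕ 2           ≡⟨ cong (λ e → N K.* e K.* fromℕ 2) fromℤ-rhs₁ ⟨
    N K.* fromℤ rhs₁ K.* fromℕ 2                      ∎)
    where
    open ≡-Reasoning
    open K-Solver using (solve; _:=_; _:+_; _:-_; _:*_; con)
    X : ℚ[√-3]
    X = fromℤ 2^[2n-3]

  lhs-when-3∤h : 1 ≤ h → ¬ 3 ℕD.∣ h → lhs (suc m) ≡ (+ suc m ℚ./ 3) ℚ.* ℤtoℚ rhs₂
  lhs-when-3∤h h≥1 3∤h = x*6≡n*E*2⇒x≡n/3*E (suc m) (lhs (suc m)) rhs₂ (begin
    K.fromℚ (lhs (suc m)) K.* fromℕ 6                 ≡⟨ lhs-closed-form h≥1 ⟩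
    closedForm S (ω K.^ h K.+ ω̄ K.^ h)               ≡⟨ cong (closedForm S) (ω^h+ω̄^h≡-1 3∤h) ⟩
    closedForm S (K.- K.1#)                           ≡⟨ solve 5 (λ n p y w s →
        n :* (con (fromℕ 2) :* (p :- y :- w) :+ s :- s :* (:- con K.1#))
        := n :* (p :+ s :- y :- w) :* con (fromℕ 2)) refl N P Y W S ⟩
    N K.* (P K.+ S K.- Y K.- W) K.* fromℕ 2           ≡⟨ cong (λ e → N K.* e K.* fromℕ 2) fromℤ-rhs₂ ⟨
    N K.* fromℤ rhs₂ K.* fromℕ 2                      ∎)
    where
    open ≡-Reasoning
    open K-Solver using (solve; _:=_; _:+_; _:-_; _:*_; :-_; con)

m≡[m/2]+[m/2] : ∀ m → suc m % 2 ≡ 1 → m ≡ m / 2 ℕ.+ m / 2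
m≡[m/2]+[m/2] m 1+m-odd with m % 2 | ℕDM.m%n<n m 2 | ℕDM.m≡m%n+[m/n]*n m 2 | ℕDM.%-distribˡ-+ 1 m 2
... | 0 | _ | m≡[m/2]*2 | _ =
  trans m≡[m/2]*2 (trans (ℕP.*-comm (m / 2) 2) (cong (m / 2 ℕ.+_) (ℕP.+-identityʳ (m / 2))))
... | 1 | _ | _ | [1+m]%2≡0 = contradiction (trans (sym [1+m]%2≡0) 1+m-odd) λ ()
... | suc (suc _) | s≤s (s≤s ()) | _ | _

2≤h+h⇒1≤h : ∀ {m h} → 2 ≤ m → m ≡ h ℕ.+ h → 1 ≤ h
2≤h+h⇒1≤h {h = suc _} _         _    = s≤s z≤n
2≤h+h⇒1≤h {h = zero}  2≤0      refl = contradiction 2≤0 λ ()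

6∣h+h⇔3∣h : ∀ {h} → 6 ℕD.∣ h ℕ.+ h ⇔ 3 ℕD.∣ h
6∣h+h⇔3∣h {h} = mk⇔ (λ 6∣h+h → ℕD.*-cancelˡ-∣ 2 (subst (6 ℕD.∣_) h+h≡2*h 6∣h+h))
                     (λ 3∣h → subst (6 ℕD.∣_) (sym h+h≡2*h) (ℕD.*-monoʳ-∣ 2 3∣h))
  where
  h+h≡2*h : h ℕ.+ h ≡ 2 ℕ.* h
  h+h≡2*h = cong (h ℕ.+_) (sym (ℕP.+-identityʳ h))

corollary2p3 : (n : ℕ) → 3 ≤ n → n % 2 ≡ 1 →
    ((6 ℕD.∣ (n ∸ 1)) →
      lhs n ≡ (ℚ._*_ (ℤ.+ n ℚ./ 3) (ℤtoℚ (+ 1 ℤ.+ (+ 2) ^ (n ∸ 1) ℤ.+ (+ 3) ^ (n ∸ 1)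
        - (+ 2) ^ (2 ℕ.* n ∸ 3) - (- (+ 12)) ^ ((n ∸ 1) / 2) - V (n ∸ 1) (+ 2) (+ 13)))))
    × ((¬ (6 ℕD.∣ (n ∸ 1))) →
      lhs n ≡ (ℚ._*_ (ℤ.+ n ℚ./ 3) (ℤtoℚ (+ 1 ℤ.+ (+ 2) ^ (n ∸ 1) ℤ.+ (+ 3) ^ (n ∸ 1)
        ℤ.+ (+ 4) ^ (n ∸ 1) - (- (+ 12)) ^ ((n ∸ 1) / 2) - V (n ∸ 1) (+ 2) (+ 13)))))
corollary2p3 (suc m) (s≤s 2≤m) n-odd =
    (λ 6∣m → lhs-when-3∣h m≡h+h h≥1 (Equivalence.to 6∣m⇔3∣h 6∣m))
  , (λ 6∤m → lhs-when-3∤h m≡h+h h≥1 (6∤m ∘ Equivalence.from 6∣m⇔3∣h))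
  where
  m≡h+h : m ≡ m / 2 ℕ.+ m / 2
  m≡h+h = m≡[m/2]+[m/2] m n-odd
  h≥1 : 1 ≤ m / 2
  h≥1 = 2≤h+h⇒1≤h 2≤m m≡h+h
  6∣m⇔3∣h : 6 ℕD.∣ m ⇔ 3 ℕD.∣ m / 2
  6∣m⇔3∣h = subst (λ k → 6 ℕD.∣ k ⇔ 3 ℕD.∣ m / 2) (sym m≡h+h) 6∣h+h⇔3∣h
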